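{- Let $K$ be a commutative field, let $a, b \in K$ with $b \neq 0$, and let $k$ be a positive integer. Write $(1 + ax + bx^2)^k = \sum_{0 \leq j \leq 2k} \alpha_j x^j$ with $\alpha_j \in K$. Then for every $j$ with $0 \leq j \leq 2k$, we have $\alpha_j = 0$ if and only if $\alpha_{2k-j} = 0$. -}

module Defs where

open import Level using (Level; _⊔_) renaming (suc to lsuc)
open import Algebra.Bundles using (CommutativeRing)
open import Data.List using (List; []; _∷_; map)
open import Data.Nat using (ℕ; zero; suc)
open import Data.Product using (Σ; _×_)
open import Relation.Nullary using (¬_)

record Field (c ℓ : Level) : Set (lsuc (c ⊔ ℓ)) where
  field
    commutativeRing : CommutativeRing c ℓ
  open CommutativeRing commutativeRing public
  field
    1≉0     : ¬ (1# ≈ 0#)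
    inverse : ∀ x → ¬ (x ≈ 0#) → Σ Carrier (λ y → x * y ≈ 1#)

-- Univariate polynomials over a commutative ring, as lists of coefficients
-- (lowest degree first).  The list [c₀, c₁, …] denotes c₀ + c₁ x + ….
module Poly {c ℓ : Level} (R : CommutativeRing c ℓ) where
  open CommutativeRing R

  Pol : Set c
  Pol = List Carrier

  coeff : Pol → ℕ → Carrier
  coeff []       _       = 0#
  coeff (p ∷ ps) zero    = p
  coeff (p ∷ ps) (suc j) = coeff ps j

  _⊕_ : Pol → Pol → Pol
  []       ⊕ qs       = qs
  (p ∷ ps) ⊕ []       = p ∷ ps
  (p ∷ ps) ⊕ (q ∷ qs) = (p + q) ∷ (ps ⊕ qs)

  -- polynomial multiplication: (p + x·P)·Q = p·Q + x·(P·Q)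
  _⊗_ : Pol → Pol → Pol
  []       ⊗ qs = []
  (p ∷ ps) ⊗ qs = map (p *_) qs ⊕ (0# ∷ (ps ⊗ qs))

  _^^_ : Pol → ℕ → Pol
  p ^^ zero  = 1# ∷ []
  p ^^ suc k = p ⊗ (p ^^ k)

module _ {c ℓ : Level} (K : Field c ℓ) where
  open Field K
  open Poly commutativeRing

  α : (a b : Carrier) (k j : ℕ) → Carrier
  α a b k j = coeff ((1# ∷ a ∷ b ∷ []) ^^ k) j

{-# OPTIONS --safe #-}
-- Write T = 1 + a x + b x².  Its reciprocal x² T(1/x) = b + a x + x² satisfies
-- (b + a (b x) + (b x)²) = b T(x), so comparing coefficients of xʲ in the k-th powers gives
-- bʲ α_{2k-j} = bᵏ α_j.  We prove this coefficientwise by induction on k, using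
-- α⁽ᵏ⁺¹⁾ₙ = α⁽ᵏ⁾ₙ + a α⁽ᵏ⁾ₙ₋₁ + b α⁽ᵏ⁾ₙ₋₂, in the form b^(2+j) αᵢ = b^(2+k) αⱼ for i + j = 2k
-- (the extra b² comes from shifting indices by two).  Since b is invertible, αᵢ and αⱼ
-- vanish together.
module Submission where

open import Defs
open import Algebra.Bundles using (CommutativeRing)
open import Data.List using ([]; _∷_; map)
import Data.Nat as ℕ
open import Data.Nat using (ℕ; zero; suc; _≤_; _<_; _∸_; z≤n; s≤s)
open import Data.Nat.Properties as ℕₚ
  using (≤-pred; +-cancelˡ-≡; +-suc; *-suc; m+[n∸m]≡n; n<1+n; m<n⇒m<1+n)
open import Data.Product using (_,_)
open import Function.Bundles using (_⇔_; mk⇔)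
open import Relation.Binary.PropositionalEquality as ≡ using (_≡_; cong)
open import Relation.Nullary using (¬_)

padded-sum : ∀ i j → (2 ℕ.+ i) ℕ.+ (2 ℕ.+ j) ≡ 4 ℕ.+ (i ℕ.+ j)
padded-sum i j = cong (2 ℕ.+_) (≡.trans (+-suc i (suc j)) (cong suc (+-suc i j)))

unpad : ∀ i j {n} → (2 ℕ.+ i) ℕ.+ (2 ℕ.+ j) ≡ 4 ℕ.+ n → i ℕ.+ j ≡ n
unpad i j e = +-cancelˡ-≡ 4 _ _ (≡.trans (≡.sym (padded-sum i j)) e)

module Coefficients {c ℓ} (R : CommutativeRing c ℓ) where
  open CommutativeRing R
  open Poly R
  open import Relation.Binary.Reasoning.Setoid setoid

  coeff-⊕ : ∀ p q n → coeff (p ⊕ q) n ≈ coeff p n + coeff q n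
  coeff-⊕ []      q       n       = sym (+-identityˡ _)
  coeff-⊕ (_ ∷ _) []      n       = sym (+-identityʳ _)
  coeff-⊕ (_ ∷ _) (_ ∷ _) zero    = refl
  coeff-⊕ (_ ∷ p) (_ ∷ q) (suc n) = coeff-⊕ p q n

  coeff-map-* : ∀ u q n → coeff (map (u *_) q) n ≈ u * coeff q n
  coeff-map-* u []      n       = sym (zeroʳ u)
  coeff-map-* u (_ ∷ _) zero    = refl
  coeff-map-* u (_ ∷ q) (suc n) = coeff-map-* u q n

  coeff-⊗-x : ∀ p q n → coeff (p ⊗ (0# ∷ q)) n ≈ coeff (0# ∷ (p ⊗ q)) n
  coeff-⊗-x []      q zero    = refl
  coeff-⊗-x []      q (suc n) = refl
  coeff-⊗-x (u ∷ p) q zero    = trans (+-identityʳ _) (zeroʳ u)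
  coeff-⊗-x (u ∷ p) q (suc n) = begin
    coeff (map (u *_) q ⊕ (p ⊗ (0# ∷ q))) n          ≈⟨ coeff-⊕ (map (u *_) q) _ n ⟩
    coeff (map (u *_) q) n + coeff (p ⊗ (0# ∷ q)) n  ≈⟨ +-congˡ (coeff-⊗-x p q n) ⟩
    coeff (map (u *_) q) n + coeff (0# ∷ (p ⊗ q)) n  ≈⟨ coeff-⊕ (map (u *_) q) _ n ⟨
    coeff (map (u *_) q ⊕ (0# ∷ (p ⊗ q))) n          ∎

  coeff-∷⊗ : ∀ u p q n → coeff ((u ∷ p) ⊗ q) n ≈ u * coeff q n + coeff (p ⊗ (0# ∷ q)) n
  coeff-∷⊗ u p q n = begin
    coeff (map (u *_) q ⊕ (0# ∷ (p ⊗ q))) n          ≈⟨ coeff-⊕ (map (u *_) q) _ n ⟩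
    coeff (map (u *_) q) n + coeff (0# ∷ (p ⊗ q)) n  ≈⟨ +-cong (coeff-map-* u q n) (sym (coeff-⊗-x p q n)) ⟩
    u * coeff q n + coeff (p ⊗ (0# ∷ q)) n           ∎

module Trinomial {c ℓ} (R : CommutativeRing c ℓ) (a b : CommutativeRing.Carrier R) where
  open CommutativeRing R
  open Poly R
  open Coefficients R
  open import Algebra.Properties.Semiring.Exp semiring using (_^_)
  open import Relation.Binary.Reasoning.Setoid setoid
  open import Algebra.Solver.Ring.NaturalCoefficients.Default commutativeSemiring

  T : Pol
  T = 1# ∷ a ∷ b ∷ []

  coeff-T⊗ : ∀ q n → coeff (T ⊗ q) n ≈ coeff q n + a * coeff (0# ∷ q) n + b * coeff (0# ∷ 0# ∷ q) n
  coeff-T⊗ q n = begin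
    coeff (T ⊗ q) n
      ≈⟨ coeff-∷⊗ 1# (a ∷ b ∷ []) q n ⟩
    1# * q₀ + coeff ((a ∷ b ∷ []) ⊗ (0# ∷ q)) n
      ≈⟨ +-cong (*-identityˡ q₀) (coeff-∷⊗ a (b ∷ []) (0# ∷ q) n) ⟩
    q₀ + (a * q₁ + coeff ((b ∷ []) ⊗ (0# ∷ 0# ∷ q)) n)
      ≈⟨ +-congˡ (+-congˡ (trans (coeff-∷⊗ b [] (0# ∷ 0# ∷ q) n) (+-identityʳ _))) ⟩
    q₀ + (a * q₁ + b * q₂)
      ≈⟨ +-assoc q₀ _ _ ⟨
    q₀ + a * q₁ + b * q₂ ∎
    where
    q₀ q₁ q₂ : Carrier
    q₀ = coeff q n
    q₁ = coeff (0# ∷ q) n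
    q₂ = coeff (0# ∷ 0# ∷ q) n

  coeff-T^^-vanishes : ∀ k n → 2 ℕ.* k < n → coeff (T ^^ k) n ≈ 0#
  coeff-T^^-vanishes zero    (suc n)       _        = refl
  coeff-T^^-vanishes (suc k) 1             (s≤s ())
  coeff-T^^-vanishes (suc k) (suc (suc n)) lt       = begin
    coeff (T ⊗ (T ^^ k)) (2 ℕ.+ n)
      ≈⟨ coeff-T⊗ (T ^^ k) (2 ℕ.+ n) ⟩
    cₖ (2 ℕ.+ n) + a * cₖ (1 ℕ.+ n) + b * cₖ n
      ≈⟨ +-cong (+-cong (vanish (m<n⇒m<1+n (m<n⇒m<1+n 2k<n))) (*-congˡ (vanish (m<n⇒m<1+n 2k<n))))
                (*-congˡ (vanish 2k<n)) ⟩
    0# + a * 0# + b * 0#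
      ≈⟨ solve 2 (λ a b → con 0 :+ a :* con 0 :+ b :* con 0 := con 0) refl a b ⟩
    0# ∎
    where
    cₖ : ℕ → Carrier
    cₖ = coeff (T ^^ k)
    vanish : ∀ {m} → 2 ℕ.* k < m → cₖ m ≈ 0#
    vanish = coeff-T^^-vanishes k _
    2k<n : 2 ℕ.* k < n
    2k<n = ≤-pred (≤-pred (≡.subst (_< 2 ℕ.+ n) (*-suc 2 k) lt))

  -- With p = bʲ and B = b^(2+k), the hypotheses are the induction hypotheses for the index
  -- pairs (i+2, j), (i+1, j+1), (i, j+2) that the recurrence for coefficients i and j involves.
  reciprocity-step : ∀ {p B X Y Z X′ Y′ Z′} →
                     p * X ≈ B * Z′ → (b * p) * Y ≈ B * Y′ → (b * (b * p)) * Z ≈ B * X′ →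
                     (b * (b * p)) * (X + a * Y + b * Z) ≈ (b * B) * (X′ + a * Y′ + b * Z′)
  reciprocity-step {p} {B} {X} {Y} {Z} {X′} {Y′} {Z′} e₁ e₂ e₃ = begin
    (b * (b * p)) * (X + a * Y + b * Z)
      ≈⟨ solve 6 (λ a b p X Y Z → (b :* (b :* p)) :* (X :+ a :* Y :+ b :* Z)
                                  := b :* (b :* (p :* X)) :+ b :* (a :* ((b :* p) :* Y)) :+ b :* ((b :* (b :* p)) :* Z))
                 refl a b p X Y Z ⟩
    b * (b * (p * X)) + b * (a * ((b * p) * Y)) + b * ((b * (b * p)) * Z)
      ≈⟨ +-cong (+-cong (*-congˡ (*-congˡ e₁)) (*-congˡ (*-congˡ e₂))) (*-congˡ e₃) ⟩
    b * (b * (B * Z′)) + b * (a * (B * Y′)) + b * (B * X′)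
      ≈⟨ solve 6 (λ a b B X′ Y′ Z′ → b :* (b :* (B :* Z′)) :+ b :* (a :* (B :* Y′)) :+ b :* (B :* X′)
                                     := (b :* B) :* (X′ :+ a :* Y′ :+ b :* Z′))
                 refl a b B X′ Y′ Z′ ⟩
    (b * B) * (X′ + a * Y′ + b * Z′) ∎

  -- Working with x²Tᵏ keeps the indices of the recurrence natural numbers; the price is
  -- the edge cases i ≤ 1 or j ≤ 1 below, where both coefficients vanish.
  x²·_ : Pol → Pol
  x²· p = 0# ∷ 0# ∷ p

  both-≈0⇒*≈* : ∀ {u v x y} → x ≈ 0# → y ≈ 0# → u * x ≈ v * y
  both-≈0⇒*≈* {u} {v} x≈0 y≈0 = trans (*-congˡ x≈0) (trans (zeroʳ u) (sym (trans (*-congˡ y≈0) (zeroʳ v))))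

  coeff-x²T^^-partner-vanishes : ∀ k i j → i ≤ 1 → i ℕ.+ j ≡ 4 ℕ.+ 2 ℕ.* k →
                                 coeff (x²· (T ^^ k)) j ≈ 0#
  coeff-x²T^^-partner-vanishes k 0             _ _        ≡.refl = coeff-T^^-vanishes k _ (m<n⇒m<1+n (n<1+n _))
  coeff-x²T^^-partner-vanishes k 1             _ _        ≡.refl = coeff-T^^-vanishes k _ (n<1+n _)
  coeff-x²T^^-partner-vanishes k (suc (suc _)) _ (s≤s ()) _

  x²T^^-reciprocal : ∀ k i j → i ℕ.+ j ≡ 4 ℕ.+ 2 ℕ.* k →
                     b ^ j * coeff (x²· (T ^^ k)) i ≈ b ^ (2 ℕ.+ k) * coeff (x²· (T ^^ k)) j
  x²T^^-reciprocal k 0 j e = both-≈0⇒*≈* refl (coeff-x²T^^-partner-vanishes k 0 j z≤n e)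
  x²T^^-reciprocal k 1 j e = both-≈0⇒*≈* refl (coeff-x²T^^-partner-vanishes k 1 j (s≤s z≤n) e)
  x²T^^-reciprocal k i@(suc (suc _)) 0 e =
    both-≈0⇒*≈* (coeff-x²T^^-partner-vanishes k 0 i z≤n (≡.trans (ℕₚ.+-comm 0 i) e)) refl
  x²T^^-reciprocal k i@(suc (suc _)) 1 e =
    both-≈0⇒*≈* (coeff-x²T^^-partner-vanishes k 1 i (s≤s z≤n) (≡.trans (ℕₚ.+-comm 1 i) e)) refl
  x²T^^-reciprocal zero (suc (suc i)) (suc (suc j)) e = centre i j (unpad i j e)
    where
    centre : ∀ m n → m ℕ.+ n ≡ 0 → b ^ (2 ℕ.+ n) * coeff (1# ∷ []) m ≈ b ^ 2 * coeff (1# ∷ []) n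
    centre zero    zero    _ = refl
    centre zero    (suc _) ()
    centre (suc _) _       ()
  x²T^^-reciprocal (suc k) (suc (suc i)) (suc (suc j)) e = begin
    b ^ (2 ℕ.+ j) * coeff (T ⊗ (T ^^ k)) i
      ≈⟨ *-congˡ (coeff-T⊗ (T ^^ k) i) ⟩
    b ^ (2 ℕ.+ j) * (cₖ (2 ℕ.+ i) + a * cₖ (1 ℕ.+ i) + b * cₖ i)
      ≈⟨ reciprocity-step (x²T^^-reciprocal k (2 ℕ.+ i) j e₁)
                          (x²T^^-reciprocal k (1 ℕ.+ i) (1 ℕ.+ j) e₂)
                          (x²T^^-reciprocal k i (2 ℕ.+ j) e₃) ⟩
    b ^ (3 ℕ.+ k) * (cₖ (2 ℕ.+ j) + a * cₖ (1 ℕ.+ j) + b * cₖ j)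
      ≈⟨ *-congˡ (coeff-T⊗ (T ^^ k) j) ⟨
    b ^ (3 ℕ.+ k) * coeff (T ⊗ (T ^^ k)) j ∎
    where
    cₖ : ℕ → Carrier
    cₖ = coeff (x²· (T ^^ k))
    i+j≡2+2k : i ℕ.+ j ≡ 2 ℕ.+ 2 ℕ.* k
    i+j≡2+2k = ≡.trans (unpad i j e) (*-suc 2 k)
    e₁ : 2 ℕ.+ i ℕ.+ j ≡ 4 ℕ.+ 2 ℕ.* k
    e₁ = cong (2 ℕ.+_) i+j≡2+2k
    e₂ : 1 ℕ.+ i ℕ.+ (1 ℕ.+ j) ≡ 4 ℕ.+ 2 ℕ.* k
    e₂ = ≡.trans (cong suc (+-suc i j)) e₁
    e₃ : i ℕ.+ (2 ℕ.+ j) ≡ 4 ℕ.+ 2 ℕ.* k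
    e₃ = ≡.trans (+-suc i (suc j)) e₂

  coeff-T^^-reciprocal : ∀ k i j → i ℕ.+ j ≡ 2 ℕ.* k →
                         b ^ (2 ℕ.+ j) * coeff (T ^^ k) i ≈ b ^ (2 ℕ.+ k) * coeff (T ^^ k) j
  coeff-T^^-reciprocal k i j e =
    x²T^^-reciprocal k (2 ℕ.+ i) (2 ℕ.+ j) (≡.trans (padded-sum i j) (cong (4 ℕ.+_) e))

module _ {c ℓ} (K : Field c ℓ) where
  open Field K
  open import Algebra.Properties.Semiring.Exp semiring using (_^_)
  open import Relation.Binary.Reasoning.Setoid setoid

  *-cancelˡ-≈0 : ∀ {b x} → ¬ b ≈ 0# → b * x ≈ 0# → x ≈ 0#
  *-cancelˡ-≈0 {b} {x} b≉0 bx≈0 with inverse b b≉0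
  ... | b⁻¹ , bb⁻¹≈1 = begin
    x              ≈⟨ *-identityˡ x ⟨
    1# * x         ≈⟨ *-congʳ bb⁻¹≈1 ⟨
    (b * b⁻¹) * x  ≈⟨ *-congʳ (*-comm b b⁻¹) ⟩
    (b⁻¹ * b) * x  ≈⟨ *-assoc b⁻¹ b x ⟩
    b⁻¹ * (b * x)  ≈⟨ *-congˡ bx≈0 ⟩
    b⁻¹ * 0#       ≈⟨ zeroʳ b⁻¹ ⟩
    0#             ∎

  ^-cancelˡ-≈0 : ∀ {b x} → ¬ b ≈ 0# → ∀ n → b ^ n * x ≈ 0# → x ≈ 0#
  ^-cancelˡ-≈0 {x = x} b≉0 zero    1x≈0    = trans (sym (*-identityˡ x)) 1x≈0
  ^-cancelˡ-≈0 {b} {x}  b≉0 (suc n) bbⁿx≈0 =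
    ^-cancelˡ-≈0 b≉0 n (*-cancelˡ-≈0 b≉0 (trans (sym (*-assoc b (b ^ n) x)) bbⁿx≈0))

  ≈0⇔≈0-up-to-^ : ∀ {b x y} → ¬ b ≈ 0# → ∀ m n → b ^ m * x ≈ b ^ n * y → (x ≈ 0# ⇔ y ≈ 0#)
  ≈0⇔≈0-up-to-^ b≉0 m n bᵐx≈bⁿy = mk⇔
    (λ x≈0 → ^-cancelˡ-≈0 b≉0 n (trans (sym bᵐx≈bⁿy) (trans (*-congˡ x≈0) (zeroʳ _))))
    (λ y≈0 → ^-cancelˡ-≈0 b≉0 m (trans bᵐx≈bⁿy (trans (*-congˡ y≈0) (zeroʳ _))))

-- Opened only now: above, these names would clash with the ring operations.
open Field using (Carrier; _≈_; 0#)
open import Data.Nat using (_*_; NonZero)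

proposition3 : ∀ {c ℓ} (K : Field c ℓ) (a b : Carrier K) → ¬ (_≈_ K b (0# K)) →
                 (k : ℕ) → .{{_ : NonZero k}} → (j : ℕ) → j ≤ 2 * k →
                 (_≈_ K (α K a b k j) (0# K)) ⇔ (_≈_ K (α K a b k (2 * k ∸ j)) (0# K))
proposition3 K a b b≉0 k j j≤2k =
  ≈0⇔≈0-up-to-^ K b≉0 (2 ℕ.+ (2 * k ∸ j)) (2 ℕ.+ k)
    (Trinomial.coeff-T^^-reciprocal (Field.commutativeRing K) a b k j (2 * k ∸ j) (m+[n∸m]≡n j≤2k))
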